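{- For every graph $G\in\mathcal{G}_\text{rec}$ there exists a placement $\rho$ such that $(G,\rho)$ is a P-framework.
   Context: For a graph $G$, two edges are related if they are opposite edges of a 4-cycle subgraph of $G$; a ribbon is an equivalence class of the reflexive–transitive closure of this relation. A ribbon $r$ separates vertices $x,y$ if they lie in different connected components of $(V_G,E_G\setminus r)$. A ribbon-cutting graph is a connected graph in which every ribbon is an edge cut (its removal disconnects the graph). A parallelogram placement of a connected graph $G$ is an injective map $\rho:V_G\to\mathbb{R}^2$ such that every 4-cycle $(u_1,u_2,u_3,u_4)$ of $G$ forms a parallelogram, i.e. $\rho(u_2)-\rho(u_1)=\rho(u_3)-\rho(u_4)$. A P-framework is a pair $(G,\rho)$ with $G$ ribbon-cutting and $\rho$ a parallelogram placement. The class $\mathcal{G}_\text{rec}$ is defined recursively: the 4-cycle graph is in $\mathcal{G}_\text{rec}$, and $\mathcal{G}_\text{rec}$ is closed under two operations. Add4-cycle: if $G\in\mathcal{G}_\text{rec}$ and $uv\in E_G$, then $(V_G\cup\{w_1,w_2\},E_G\cup\{uw_1,w_1w_2,w_2v\})$ with new vertices $w_1,w_2\notin V_G$ is in $\mathcal{G}_\text{rec}$. Close4-cycle: if $G\in\mathcal{G}_\text{rec}$ with $uv,vw\in E_G$ such that for every vertex $x\in V_G\setminus\{u,v,w\}$ there is a ribbon of $G$ containing neither $uv$ nor $vw$ that separates $v$ and $x$, then $(V_G\cup\{w'\},E_G\cup\{uw',w'w\})$ with a new vertex $w'\notin V_G$ is in $\mathcal{G}_\text{rec}$. -}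

module Defs where

open import Data.Nat using (ℕ; zero; suc)
open import Data.Fin using (Fin; zero; suc; _≟_)
open import Data.Bool using (Bool; true; false; _∨_)
open import Data.Product using (_×_; _,_; proj₁; proj₂; Σ; ∃)
open import Data.Rational using (ℚ; _-_)
open import Relation.Nullary using (¬_)
open import Relation.Nullary.Decidable using (⌊_⌋)
open import Relation.Binary.PropositionalEquality using (_≡_; _≢_)
open import Relation.Binary.Construct.Closure.ReflexiveTransitive using (Star)
open import Function.Bundles using (_↔_; Inverse)
open import Function.Definitions using (Injective)

-- Finite simple graphs on the vertex set Fin n, given by a Boolean
-- adjacency function (symmetry/irreflexivity are preserved by every
-- construction below, starting from the 4-cycle).

Graph : ℕ → Set
Graph n = Fin n → Fin n → Bool

module _ {n : ℕ} (G : Graph n) where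

  Edge : Fin n → Fin n → Set
  Edge a b = G a b ≡ true

  FourCycle : Fin n → Fin n → Fin n → Fin n → Set
  FourCycle a b c d =
    (a ≢ b × a ≢ c × a ≢ d × b ≢ c × b ≢ d × c ≢ d) ×
    (Edge a b × Edge b c × Edge c d × Edge d a)

  data RibStep : (Fin n × Fin n) → (Fin n × Fin n) → Set where
    opp  : ∀ {a b c d} → FourCycle a b c d → RibStep (a , b) (c , d)
    flip : ∀ {a b} → RibStep (a , b) (b , a)

  SameRibbon : (Fin n × Fin n) → (Fin n × Fin n) → Set
  SameRibbon = Star RibStep

  InRibbon : (Fin n × Fin n) → (Fin n × Fin n) → Set
  InRibbon e (a , b) = Edge a b × SameRibbon e (a , b)

  EdgeWithout : (Fin n × Fin n) → Fin n → Fin n → Set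
  EdgeWithout e a b = Edge a b × ¬ InRibbon e (a , b)

  Connected : Set
  Connected = ∀ x y → Star Edge x y

  Separates : (Fin n × Fin n) → Fin n → Fin n → Set
  Separates e x y = ¬ Star (EdgeWithout e) x y

  RibbonCutting : Set
  RibbonCutting =
    Connected ×
    (∀ a b → Edge a b → ¬ (∀ x y → Star (EdgeWithout (a , b)) x y))

Point : Set
Point = ℚ × ℚ

_-ᵥ_ : Point → Point → Point
(x₁ , y₁) -ᵥ (x₂ , y₂) = (x₁ - x₂ , y₁ - y₂)

ParallelogramPlacement : {n : ℕ} → Graph n → (Fin n → Point) → Set
ParallelogramPlacement G ρ =
  Injective _≡_ _≡_ ρ ×
  (∀ u₁ u₂ u₃ u₄ → FourCycle G u₁ u₂ u₃ u₄ →
     (ρ u₂ -ᵥ ρ u₁) ≡ (ρ u₃ -ᵥ ρ u₄))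

PFramework : {n : ℕ} → Graph n → (Fin n → Point) → Set
PFramework G ρ = RibbonCutting G × ParallelogramPlacement G ρ

C4 : Graph 4
C4 zero (suc zero) = true
C4 (suc zero) zero = true
C4 (suc zero) (suc (suc zero)) = true
C4 (suc (suc zero)) (suc zero) = true
C4 (suc (suc zero)) (suc (suc (suc zero))) = true
C4 (suc (suc (suc zero))) (suc (suc zero)) = true
C4 (suc (suc (suc zero))) zero = true
C4 zero (suc (suc (suc zero))) = true
C4 _ _ = false

-- Add4-cycle on edge uv: new vertices w₁ = zero, w₂ = suc zero,
-- old vertex x becomes suc (suc x); new edges u w₁, w₁ w₂, w₂ v.
add4 : {n : ℕ} → Graph n → Fin n → Fin n → Graph (suc (suc n))
add4 G u v zero zero = false
add4 G u v zero (suc zero) = true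
add4 G u v zero (suc (suc x)) = ⌊ x ≟ u ⌋
add4 G u v (suc zero) zero = true
add4 G u v (suc zero) (suc zero) = false
add4 G u v (suc zero) (suc (suc x)) = ⌊ x ≟ v ⌋
add4 G u v (suc (suc x)) zero = ⌊ x ≟ u ⌋
add4 G u v (suc (suc x)) (suc zero) = ⌊ x ≟ v ⌋
add4 G u v (suc (suc x)) (suc (suc y)) = G x y

-- Close4-cycle on edges uv, vw: new vertex w' = zero, old vertex x
-- becomes suc x; new edges u w', w' w.
close4 : {n : ℕ} → Graph n → Fin n → Fin n → Graph (suc n)
close4 G u w zero zero = false
close4 G u w zero (suc x) = ⌊ x ≟ u ⌋ ∨ ⌊ x ≟ w ⌋
close4 G u w (suc x) zero = ⌊ x ≟ u ⌋ ∨ ⌊ x ≟ w ⌋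
close4 G u w (suc x) (suc y) = G x y

CloseCondition : {n : ℕ} → Graph n → Fin n → Fin n → Fin n → Set
CloseCondition G u v w =
  ∀ x → x ≢ u → x ≢ v → x ≢ w →
  Σ (Fin _ × Fin _) λ e →
    Edge G (proj₁ e) (proj₂ e) ×
    ¬ InRibbon G e (u , v) × ¬ InRibbon G e (v , w) ×
    Separates G e v x

-- G_rec, closed under relabelling of vertices (graphs are taken up to
-- isomorphism: the vertex names of the new vertices are arbitrary).
data Rec : {n : ℕ} → Graph n → Set where
  base    : Rec C4
  add4C   : ∀ {n} {G : Graph n} {u v} → Rec G → Edge G u v → Rec (add4 G u v)
  close4C : ∀ {n} {G : Graph n} {u v w} → Rec G →
            Edge G u v → Edge G v w → u ≢ w →
            CloseCondition G u v w → Rec (close4 G u w)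
  relabel : ∀ {n} {G H : Graph n} → Rec G → (σ : Fin n ↔ Fin n) →
            (∀ a b → H a b ≡ G (Inverse.to σ a) (Inverse.to σ b)) → Rec H

{-# OPTIONS --safe #-}
module Submission where

-- Every graph of G_rec has a labelling of its vertices by points of a hypercube
-- {0,1}^dim in which each edge flips exactly one coordinate, all edges flipping
-- a given coordinate lie in one ribbon, and any two vertices on the same side of
-- a coordinate are joined by a path that never flips it. In a 4-cycle opposite
-- edges then flip the same coordinate in the same direction, so reading labels
-- as binary numbers places the vertices injectively on a line with every 4-cycle
-- a (degenerate) parallelogram; and a path avoiding the ribbon of an edge e never
-- changes the coordinate flipped by e, so every ribbon is a cut. Add4-cycle keeps
-- such a labelling by adding one coordinate that separates the new path from the
-- old graph; Close4-cycle by giving w′ the fourth corner u + w − v of the square,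
-- which the side condition guarantees to be free.

open import Defs
open import Data.Bool using (Bool; true; false; _∨_; _xor_)
open import Data.Bool.Properties using (¬-not; xor-same; xor-assoc; xor-identityʳ)
import Data.Bool.Properties as Bool
open import Data.Empty using (⊥-elim)
open import Data.Fin using (Fin; zero; suc; _≟_)
open import Data.Fin.Patterns using (0F; 1F; 2F; 3F)
open import Data.Fin.Permutation using (transpose)
open import Data.Fin.Properties using (suc-injective; all?)
open import Data.Nat using (ℕ; zero; suc; _+_; _*_; _%_)
open import Data.Nat.DivMod using ([m+kn]%n≡m%n)
import Data.Nat.Properties as ℕ
open import Data.Nat.Solver using (module +-*-Solver)
open import Data.Product using (Σ; _×_; _,_; proj₁; proj₂)
import Data.Product as Product
open import Data.Rational as ℚ using (ℚ; 0ℚ; 1ℚ; _-_)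
import Data.Rational.Properties as ℚₚ
open import Data.Rational.Solver renaming (module +-*-Solver to ℚ-Solver)
open import Algebra.Properties.Group ℚₚ.+-0-group using (∙-cancelˡ)
open import Data.Sum using (_⊎_; inj₁; inj₂)
open import Function using (_∘_; id)
open import Function.Bundles using (Equivalence; _↔_; Inverse)
open import Function.Definitions using (Injective)
open import Relation.Binary.Construct.Closure.ReflexiveTransitive as Star
  using (Star; ε; _◅_; _◅◅_; gmap; fold; reverse)
open import Relation.Binary.PropositionalEquality
open import Relation.Nullary using (¬_; yes; no; contradiction)
open import Relation.Nullary.Decidable using (⌊_⌋; toWitness; fromWitness; decidable-stable; from-yes)

bit : Bool → ℕ
bit false = 0
bit true  = 1

bit-injective : ∀ {a b} → bit a ≡ bit b → a ≡ b
bit-injective {false} {false} _ = refl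
bit-injective {true}  {true}  _ = refl

bit%2 : ∀ a → bit a % 2 ≡ bit a
bit%2 false = refl
bit%2 true  = refl

bit+*2-injective : ∀ {a b} m n → bit a + m * 2 ≡ bit b + n * 2 → a ≡ b × m ≡ n
bit+*2-injective {a} {b} m n eq = a≡b , ℕ.*-cancelʳ-≡ m n 2 (ℕ.+-cancelˡ-≡ (bit a) _ _ eq′)
  where
  open ≡-Reasoning
  a≡b : a ≡ b
  a≡b = bit-injective (begin
    bit a               ≡⟨ bit%2 a ⟨
    bit a % 2           ≡⟨ [m+kn]%n≡m%n (bit a) m 2 ⟨
    (bit a + m * 2) % 2 ≡⟨ cong (_% 2) eq ⟩
    (bit b + n * 2) % 2 ≡⟨ [m+kn]%n≡m%n (bit b) n 2 ⟩
    bit b % 2           ≡⟨ bit%2 b ⟩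
    bit b               ∎)
  eq′ : bit a + m * 2 ≡ bit a + n * 2
  eq′ = trans eq (cong (λ c → bit c + n * 2) (sym a≡b))

encode : ∀ {k} → (Fin k → Bool) → ℕ
encode {zero}  f = 0
encode {suc k} f = bit (f zero) + encode (f ∘ suc) * 2

encode-injective : ∀ {k} (f g : Fin k → Bool) → encode f ≡ encode g → ∀ i → f i ≡ g i
encode-injective {suc k} f g eq zero    = proj₁ (bit+*2-injective (encode (f ∘ suc)) (encode (g ∘ suc)) eq)
encode-injective {suc k} f g eq (suc i) =
  encode-injective (f ∘ suc) (g ∘ suc) (proj₂ (bit+*2-injective (encode (f ∘ suc)) (encode (g ∘ suc)) eq)) i

+*2-interchange : ∀ a m b n → (a + m * 2) + (b + n * 2) ≡ (a + b) + (m + n) * 2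
+*2-interchange =
  solve 4 (λ a m b n → (a :+ m :* con 2) :+ (b :+ n :* con 2) := (a :+ b) :+ (m :+ n) :* con 2) refl
  where open +-*-Solver

encode-+ : ∀ {k} (f g h i : Fin k → Bool) → (∀ j → bit (f j) + bit (g j) ≡ bit (h j) + bit (i j)) →
           encode f + encode g ≡ encode h + encode i
encode-+ {zero}  f g h i eq = refl
encode-+ {suc k} f g h i eq = begin
  encode f + encode g
    ≡⟨ +*2-interchange (bit (f zero)) (encode (f ∘ suc)) (bit (g zero)) (encode (g ∘ suc)) ⟩
  (bit (f zero) + bit (g zero)) + (encode (f ∘ suc) + encode (g ∘ suc)) * 2
    ≡⟨ cong₂ (λ x y → x + y * 2) (eq zero) (encode-+ (f ∘ suc) (g ∘ suc) (h ∘ suc) (i ∘ suc) (eq ∘ suc)) ⟩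
  (bit (h zero) + bit (i zero)) + (encode (h ∘ suc) + encode (i ∘ suc)) * 2
    ≡⟨ +*2-interchange (bit (h zero)) (encode (h ∘ suc)) (bit (i zero)) (encode (i ∘ suc)) ⟨
  encode h + encode i
    ∎
  where open ≡-Reasoning

ℕ→ℚ : ℕ → ℚ
ℕ→ℚ zero    = 0ℚ
ℕ→ℚ (suc n) = 1ℚ ℚ.+ ℕ→ℚ n

ℕ→ℚ-+ : ∀ m n → ℕ→ℚ (m + n) ≡ ℕ→ℚ m ℚ.+ ℕ→ℚ n
ℕ→ℚ-+ zero    n = sym (ℚₚ.+-identityˡ (ℕ→ℚ n))
ℕ→ℚ-+ (suc m) n = trans (cong (1ℚ ℚ.+_) (ℕ→ℚ-+ m n)) (sym (ℚₚ.+-assoc 1ℚ (ℕ→ℚ m) (ℕ→ℚ n)))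

ℕ→ℚ-nonNegative : ∀ n → 0ℚ ℚ.≤ ℕ→ℚ n
ℕ→ℚ-nonNegative zero    = ℚₚ.≤-refl
ℕ→ℚ-nonNegative (suc n) = ℚₚ.+-mono-≤ (ℚₚ.nonNegative⁻¹ 1ℚ) (ℕ→ℚ-nonNegative n)

ℕ→ℚ-suc-positive : ∀ n → 0ℚ ℚ.< ℕ→ℚ (suc n)
ℕ→ℚ-suc-positive n = ℚₚ.+-mono-<-≤ (ℚₚ.positive⁻¹ 1ℚ) (ℕ→ℚ-nonNegative n)

ℕ→ℚ-injective : ∀ m n → ℕ→ℚ m ≡ ℕ→ℚ n → m ≡ n
ℕ→ℚ-injective zero    zero    _  = refl
ℕ→ℚ-injective zero    (suc n) eq = ⊥-elim (ℚₚ.<-irrefl eq (ℕ→ℚ-suc-positive n))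
ℕ→ℚ-injective (suc m) zero    eq = ⊥-elim (ℚₚ.<-irrefl (sym eq) (ℕ→ℚ-suc-positive m))
ℕ→ℚ-injective (suc m) (suc n) eq = cong suc (ℕ→ℚ-injective m n (∙-cancelˡ 1ℚ (ℕ→ℚ m) (ℕ→ℚ n) eq))

+≡+⇒-≡- : ∀ x y z w → x ℚ.+ w ≡ y ℚ.+ z → x - y ≡ z - w
+≡+⇒-≡- x y z w eq = begin
  x - y                   ≡⟨ shift x y w ⟩
  (x ℚ.+ w) - (y ℚ.+ w)   ≡⟨ cong (_- (y ℚ.+ w)) eq ⟩
  (y ℚ.+ z) - (y ℚ.+ w)   ≡⟨ cancel y z w ⟩
  z - w                   ∎
  where
  open ≡-Reasoning
  open ℚ-Solver
  shift : ∀ x y w → x - y ≡ (x ℚ.+ w) - (y ℚ.+ w)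
  shift = solve 3 (λ x y w → x :- y := (x :+ w) :- (y :+ w)) refl
  cancel : ∀ y z w → (y ℚ.+ z) - (y ℚ.+ w) ≡ z - w
  cancel = solve 3 (λ y z w → (y :+ z) :- (y :+ w) := z :- w) refl

xor-cancelʳ : ∀ a {b c} → b ≡ c → a xor b xor c ≡ a
xor-cancelʳ a {b} refl = trans (cong (a xor_) (xor-same b)) (xor-identityʳ a)

xor-cancelˡ : ∀ {a b} c → a ≡ b → a xor b xor c ≡ c
xor-cancelˡ {a} c refl = trans (sym (xor-assoc a a c)) (cong (_xor c) (xor-same a))

xor-cancelʳ⁻¹ : ∀ a b c → a xor b xor c ≡ a → b ≡ c
xor-cancelʳ⁻¹ false false false _ = refl
xor-cancelʳ⁻¹ false true  true  _ = refl
xor-cancelʳ⁻¹ true  false false _ = refl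
xor-cancelʳ⁻¹ true  true  true  _ = refl
xor-cancelʳ⁻¹ false false true  ()
xor-cancelʳ⁻¹ false true  false ()
xor-cancelʳ⁻¹ true  false true  ()
xor-cancelʳ⁻¹ true  true  false ()

xor-cancelˡ⁻¹ : ∀ a b c → a xor b xor c ≡ c → a ≡ b
xor-cancelˡ⁻¹ false false _     _ = refl
xor-cancelˡ⁻¹ true  true  _     _ = refl
xor-cancelˡ⁻¹ false true  false ()
xor-cancelˡ⁻¹ false true  true  ()
xor-cancelˡ⁻¹ true  false false ()
xor-cancelˡ⁻¹ true  false true  ()

xor-middle⁻¹ : ∀ a b c → a xor b xor c ≡ b → a ≡ c
xor-middle⁻¹ false _     false _ = refl
xor-middle⁻¹ true  _     true  _ = refl
xor-middle⁻¹ false false true  ()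
xor-middle⁻¹ false true  true  ()
xor-middle⁻¹ true  false false ()
xor-middle⁻¹ true  true  false ()

square-disjunction : ∀ {P Q R S : Set} → P ⊎ Q → Q ⊎ R → R ⊎ S → S ⊎ P → (P × R) ⊎ (Q × S)
square-disjunction (inj₁ p) _        (inj₁ r) _        = inj₁ (p , r)
square-disjunction (inj₁ p) (inj₁ q) (inj₂ s) _        = inj₂ (q , s)
square-disjunction (inj₁ p) (inj₂ r) (inj₂ s) _        = inj₁ (p , r)
square-disjunction (inj₂ q) _        _        (inj₁ s) = inj₂ (q , s)
square-disjunction (inj₂ q) _        (inj₁ r) (inj₂ p) = inj₁ (p , r)
square-disjunction (inj₂ q) _        (inj₂ s) (inj₂ p) = inj₂ (q , s)

module _ {n : ℕ} {G : Graph n} where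

  FourCycle-rotate : ∀ {a b c d} → FourCycle G a b c d → FourCycle G b c d a
  FourCycle-rotate ((a≢b , a≢c , a≢d , b≢c , b≢d , c≢d) , (ab , bc , cd , da)) =
    (b≢c , b≢d , ≢-sym a≢b , c≢d , ≢-sym a≢c , ≢-sym a≢d) , (bc , cd , da , ab)

  RibStep-sym : ∀ {e f} → RibStep G e f → RibStep G f e
  RibStep-sym (opp c) = opp (FourCycle-rotate (FourCycle-rotate c))
  RibStep-sym flip    = flip

  SameRibbon-sym : ∀ {e f} → SameRibbon G e f → SameRibbon G f e
  SameRibbon-sym = reverse RibStep-sym

  connected-via : (∀ {a b} → Edge G a b → Edge G b a) →
                  (r : Fin n) → (∀ x → Star (Edge G) x r) → Connected G
  connected-via edge-sym r to-r x y = to-r x ◅◅ reverse edge-sym (to-r y)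

module EdgeEmbedding {m n : ℕ} {G : Graph m} {H : Graph n} (f : Fin m → Fin n)
                     (f-injective : Injective _≡_ _≡_ f)
                     (f-edge : ∀ {a b} → Edge G a b → Edge H (f a) (f b)) where

  FourCycle-map : ∀ {a b c d} → FourCycle G a b c d → FourCycle H (f a) (f b) (f c) (f d)
  FourCycle-map ((a≢b , a≢c , a≢d , b≢c , b≢d , c≢d) , (ab , bc , cd , da)) =
    (f≢ a≢b , f≢ a≢c , f≢ a≢d , f≢ b≢c , f≢ b≢d , f≢ c≢d) , (f-edge ab , f-edge bc , f-edge cd , f-edge da)
    where
    f≢ : ∀ {x y} → x ≢ y → f x ≢ f y
    f≢ x≢y = x≢y ∘ f-injective

  SameRibbon-map : ∀ {e e′} → SameRibbon G e e′ → SameRibbon H (Product.map f f e) (Product.map f f e′)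
  SameRibbon-map = gmap (Product.map f f) λ { (opp c) → opp (FourCycle-map c) ; flip → flip }

  path-map : ∀ {x y} → Star (Edge G) x y → Star (Edge H) (f x) (f y)
  path-map = gmap f f-edge

-- A record rather than a product, so that its indices can be inferred from its type.
record NonCrossingEdge {n k} (G : Graph n) (label : Fin n → Fin k → Bool) (i : Fin k) (a b : Fin n) : Set where
  constructor noncrossing
  field
    edge  : Edge G a b
    fixed : label a i ≡ label b i

NonCrossingEdge-sym : ∀ {n k} {G : Graph n} {label : Fin n → Fin k → Bool} {i} →
                      (∀ {a b} → Edge G a b → Edge G b a) →
                      ∀ {a b} → NonCrossingEdge G label i a b → NonCrossingEdge G label i b a
NonCrossingEdge-sym edge-sym (noncrossing ab fixed) = noncrossing (edge-sym ab) (sym fixed)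

record CubeEmbedding {n : ℕ} (G : Graph n) : Set where
  field
    dim                    : ℕ
    label                  : Fin n → Fin dim → Bool
    label-injective        : ∀ {x y} → (∀ i → label x i ≡ label y i) → x ≡ y
    edge-sym               : ∀ {a b} → Edge G a b → Edge G b a
    direction              : ∀ {a b} → Edge G a b → Fin dim
    direction-crossed      : ∀ {a b} (e : Edge G a b) → label a (direction e) ≢ label b (direction e)
    others-fixed           : ∀ {a b} (e : Edge G a b) i → i ≢ direction e → label a i ≡ label b i
    anchor                 : Fin dim → Fin n × Fin n
    crossing-anchor-ribbon : ∀ i {a b} → Edge G a b → label a i ≢ label b i →
                             SameRibbon G (anchor i) (a , b)
    halfspace-connected    : ∀ i {x y} → label x i ≡ label y i → Star (NonCrossingEdge G label i) x y
    connected              : Connected G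

module CubeEmbeddingProperties {n : ℕ} {G : Graph n} (C : CubeEmbedding G) where
  open CubeEmbedding C

  Crosses : Fin dim → Fin n × Fin n → Set
  Crosses i (a , b) = label a i ≢ label b i

  edge-irreflexive : ∀ {a b} → Edge G a b → a ≢ b
  edge-irreflexive e refl = direction-crossed e refl

  crossing⇒others-fixed : ∀ {a b i} → Edge G a b → Crosses i (a , b) →
                          ∀ j → j ≢ i → label a j ≡ label b j
  crossing⇒others-fixed {i = i} e cr j j≢i = others-fixed e j (λ j≡d → j≢i (trans j≡d (sym i≡d)))
    where
    i≡d : i ≡ direction e
    i≡d = decidable-stable (i ≟ direction e) (cr ∘ others-fixed e i)

  path₂-crosses-at-most-once : ∀ {a b c} → Edge G a b → Edge G b c → a ≢ c →
                               ∀ i → label a i ≡ label b i ⊎ label b i ≡ label c i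
  path₂-crosses-at-most-once {a} {b} {c} ab bc a≢c i
    with label a i Bool.≟ label b i | label b i Bool.≟ label c i
  ... | yes a≡b | _        = inj₁ a≡b
  ... | no _    | yes b≡c  = inj₂ b≡c
  ... | no a≢b  | no b≢c   = ⊥-elim (a≢c (label-injective agree))
    where
    agree : ∀ j → label a j ≡ label c j
    agree j with j ≟ i
    ... | yes refl = trans (¬-not a≢b) (sym (¬-not (≢-sym b≢c)))
    ... | no j≢i   = trans (crossing⇒others-fixed ab a≢b j j≢i) (crossing⇒others-fixed bc b≢c j j≢i)

  four-cycle-coordinate : ∀ {a b c d} → FourCycle G a b c d → ∀ i →
                          (label a i ≡ label b i × label c i ≡ label d i) ⊎
                          (label b i ≡ label c i × label d i ≡ label a i)
  four-cycle-coordinate ((_ , a≢c , _ , _ , b≢d , _) , (ab , bc , cd , da)) i =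
    square-disjunction (path₂-crosses-at-most-once ab bc a≢c i)
                       (path₂-crosses-at-most-once bc cd b≢d i)
                       (path₂-crosses-at-most-once cd da (≢-sym a≢c) i)
                       (path₂-crosses-at-most-once da ab (≢-sym b≢d) i)

  four-cycle-bits : ∀ {a b c d} → FourCycle G a b c d → ∀ i →
                    bit (label b i) + bit (label d i) ≡ bit (label a i) + bit (label c i)
  four-cycle-bits {a} {b} {c} {d} fc i with four-cycle-coordinate fc i
  ... | inj₁ (a≡b , c≡d) = cong₂ (λ x y → bit x + bit y) (sym a≡b) (sym c≡d)
  ... | inj₂ (b≡c , d≡a) =
    trans (ℕ.+-comm (bit (label b i)) _) (cong₂ (λ x y → bit x + bit y) d≡a b≡c)

  opposite-edges-cross-together : ∀ {a b c d i} → FourCycle G a b c d →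
                                  Crosses i (a , b) → Crosses i (c , d)
  opposite-edges-cross-together {i = i} fc cr with four-cycle-coordinate fc i
  ... | inj₁ (a≡b , _)   = ⊥-elim (cr a≡b)
  ... | inj₂ (b≡c , d≡a) = λ c≡d → cr (trans (sym d≡a) (trans (sym c≡d) (sym b≡c)))

  SameRibbon-preserves-Crosses : ∀ {i e f} → SameRibbon G e f → Crosses i e → Crosses i f
  SameRibbon-preserves-Crosses {i} = fold (λ e f → Crosses i e → Crosses i f) step id
    where
    step : ∀ {e f g} → RibStep G e f → (Crosses i f → Crosses i g) → Crosses i e → Crosses i g
    step (opp fc) k = k ∘ opposite-edges-cross-together fc
    step flip     k = k ∘ ≢-sym

  crossing⇒SameRibbon : ∀ {a b x y i} → Edge G a b → Edge G x y →
                        Crosses i (a , b) → Crosses i (x , y) → SameRibbon G (a , b) (x , y)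
  crossing⇒SameRibbon {i = i} ab xy p q =
    SameRibbon-sym (crossing-anchor-ribbon i ab p) ◅◅ crossing-anchor-ribbon i xy q

  outside-ribbon⇒fixed : ∀ {a b x y} (e : Edge G a b) → Edge G x y → ¬ InRibbon G (a , b) (x , y) →
                         label x (direction e) ≡ label y (direction e)
  outside-ribbon⇒fixed {x = x} {y} e xy ∉ =
    decidable-stable (label x (direction e) Bool.≟ label y (direction e))
                     (λ cr → ∉ (xy , crossing⇒SameRibbon e xy (direction-crossed e) cr))

  ribbon-avoiding-path-fixes : ∀ {a b x y} (e : Edge G a b) → Star (EdgeWithout G (a , b)) x y →
                               label x (direction e) ≡ label y (direction e)
  ribbon-avoiding-path-fixes e =
    fold (λ x y → label x (direction e) ≡ label y (direction e))
         (λ (xy , ∉) → trans (outside-ribbon⇒fixed e xy ∉)) refl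

  separated⇒crossing : ∀ {a b x y} (e : Edge G a b) → Separates G (a , b) x y →
                       Crosses (direction e) (x , y)
  separated⇒crossing e sep same-side = sep (Star.map avoids (halfspace-connected (direction e) same-side))
    where
    avoids : ∀ {p q} → NonCrossingEdge G label (direction e) p q → EdgeWithout G _ p q
    avoids (noncrossing pq fixed) = pq , λ (_ , r) → SameRibbon-preserves-Crosses r (direction-crossed e) fixed

  ribbonCutting : RibbonCutting G
  ribbonCutting = connected , λ a b e all → direction-crossed e (ribbon-avoiding-path-fixes e (all a b))

  position : Fin n → ℚ
  position x = ℕ→ℚ (encode (label x))

  placement : Fin n → Point
  placement x = position x , 0ℚ

  placement-injective : Injective _≡_ _≡_ placement
  placement-injective {x} {y} eq =
    label-injective (encode-injective (label x) (label y) (ℕ→ℚ-injective _ _ (cong proj₁ eq)))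

  placement-parallelogram : ∀ u₁ u₂ u₃ u₄ → FourCycle G u₁ u₂ u₃ u₄ →
                            (placement u₂ -ᵥ placement u₁) ≡ (placement u₃ -ᵥ placement u₄)
  placement-parallelogram a b c d fc =
    cong (_, 0ℚ - 0ℚ) (+≡+⇒-≡- (position b) (position a) (position c) (position d) sums)
    where
    open ≡-Reasoning
    sums : position b ℚ.+ position d ≡ position a ℚ.+ position c
    sums = begin
      position b ℚ.+ position d
        ≡⟨ ℕ→ℚ-+ (encode (label b)) _ ⟨
      ℕ→ℚ (encode (label b) + encode (label d))
        ≡⟨ cong ℕ→ℚ (encode-+ (label b) (label d) (label a) (label c) (four-cycle-bits fc)) ⟩
      ℕ→ℚ (encode (label a) + encode (label c))
        ≡⟨ ℕ→ℚ-+ (encode (label a)) _ ⟩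
      position a ℚ.+ position c
        ∎

  pFramework : Σ (Fin n → Point) (PFramework G)
  pFramework = placement , ribbonCutting , placement-injective , placement-parallelogram

⌊≟⌋-diag : ∀ {n} (x : Fin n) → ⌊ x ≟ x ⌋ ≡ true
⌊≟⌋-diag x = Equivalence.to Bool.T-≡ (fromWitness refl)

⌊≟⌋⇒≡ : ∀ {n} {x y : Fin n} → ⌊ x ≟ y ⌋ ≡ true → x ≡ y
⌊≟⌋⇒≡ = toWitness ∘ Equivalence.from Bool.T-≡

⌊≟⌋∨⌊≟⌋⇒≡⊎≡ : ∀ {n} {x y z : Fin n} → ⌊ x ≟ y ⌋ ∨ ⌊ x ≟ z ⌋ ≡ true → x ≡ y ⊎ x ≡ z
⌊≟⌋∨⌊≟⌋⇒≡⊎≡ {x = x} {y} {z} h with x ≟ y | x ≟ z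
... | yes x≡y | _        = inj₁ x≡y
... | no _    | yes x≡z  = inj₂ x≡z
... | no _    | no _     = contradiction h λ ()

data ExtendedEdge {m n : ℕ} (G : Graph m) (embed : Fin m → Fin n) (New : Fin n → Fin n → Set) :
                  Fin n → Fin n → Set where
  old-edge   : ∀ {x y} → Edge G x y → ExtendedEdge G embed New (embed x) (embed y)
  new-edge   : ∀ {a b} → New a b → ExtendedEdge G embed New a b
  new-edge⁻¹ : ∀ {a b} → New a b → ExtendedEdge G embed New b a

module Add4 {n : ℕ} {G : Graph n} (C : CubeEmbedding G) {u v : Fin n} (uv : Edge G u v) where
  open CubeEmbedding C
  open CubeEmbeddingProperties C using (edge-irreflexive)

  G′ : Graph (suc (suc n))
  G′ = add4 G u v

  pattern w₁    = zero
  pattern w₂    = suc zero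
  pattern old x = suc (suc x)

  embed : Fin n → Fin (suc (suc n))
  embed x = old x

  embed-injective : Injective _≡_ _≡_ embed
  embed-injective refl = refl

  open EdgeEmbedding {G = G} {H = G′} embed embed-injective (λ e → e)

  edge-sym′ : ∀ {a b} → Edge G′ a b → Edge G′ b a
  edge-sym′ {w₁}    {w₂}    _ = refl
  edge-sym′ {w₂}    {w₁}    _ = refl
  edge-sym′ {w₁}    {old _} e = e
  edge-sym′ {w₂}    {old _} e = e
  edge-sym′ {old _} {w₁}    e = e
  edge-sym′ {old _} {w₂}    e = e
  edge-sym′ {old _} {old _} e = edge-sym e

  edge-u-w₁ : Edge G′ (old u) w₁
  edge-u-w₁ = ⌊≟⌋-diag u
  edge-w₁-u : Edge G′ w₁ (old u)
  edge-w₁-u = ⌊≟⌋-diag u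
  edge-w₂-v : Edge G′ w₂ (old v)
  edge-w₂-v = ⌊≟⌋-diag v

  square : FourCycle G′ (old u) w₁ w₂ (old v)
  square = ((λ ()) , (λ ()) , edge-irreflexive uv ∘ embed-injective , (λ ()) , (λ ()) , (λ ()))
         , (edge-u-w₁ , refl , edge-w₂-v , edge-sym uv)

  square⁻¹ : FourCycle G′ (old v) (old u) w₁ w₂
  square⁻¹ = rotate (rotate (rotate square))
    where rotate = FourCycle-rotate {G = G′}

  label′ : Fin (suc (suc n)) → Fin (suc dim) → Bool
  label′ w₁      zero    = true
  label′ w₂      zero    = true
  label′ (old x) zero    = false
  label′ w₁      (suc i) = label u i
  label′ w₂      (suc i) = label v i
  label′ (old x) (suc i) = label x i

  label′-injective : ∀ {x y} → (∀ i → label′ x i ≡ label′ y i) → x ≡ y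
  label′-injective {w₁}    {w₁}    _    = refl
  label′-injective {w₁}    {w₂}    same = ⊥-elim (edge-irreflexive uv (label-injective (same ∘ suc)))
  label′-injective {w₂}    {w₁}    same = ⊥-elim (edge-irreflexive uv (label-injective (sym ∘ same ∘ suc)))
  label′-injective {w₂}    {w₂}    _    = refl
  label′-injective {old x} {old y} same = cong embed (label-injective (same ∘ suc))
  label′-injective {w₁}    {old _} same = contradiction (same zero) λ ()
  label′-injective {w₂}    {old _} same = contradiction (same zero) λ ()
  label′-injective {old _} {w₁}    same = contradiction (same zero) λ ()
  label′-injective {old _} {w₂}    same = contradiction (same zero) λ ()

  data NewEdge : Fin (suc (suc n)) → Fin (suc (suc n)) → Set where
    u-w₁  : NewEdge (old u) w₁
    w₁-w₂ : NewEdge w₁ w₂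
    w₂-v  : NewEdge w₂ (old v)

  Edge′ : Fin (suc (suc n)) → Fin (suc (suc n)) → Set
  Edge′ = ExtendedEdge G embed NewEdge

  classify : ∀ {a b} → Edge G′ a b → Edge′ a b
  classify {w₁}    {w₂}    _ = new-edge w₁-w₂
  classify {w₂}    {w₁}    _ = new-edge⁻¹ w₁-w₂
  classify {w₁}    {old x} e with refl ← ⌊≟⌋⇒≡ e = new-edge⁻¹ u-w₁
  classify {w₂}    {old x} e with refl ← ⌊≟⌋⇒≡ e = new-edge w₂-v
  classify {old x} {w₁}    e with refl ← ⌊≟⌋⇒≡ e = new-edge u-w₁
  classify {old x} {w₂}    e with refl ← ⌊≟⌋⇒≡ e = new-edge⁻¹ w₂-v
  classify {old x} {old y} e = old-edge e

  new-direction : ∀ {a b} → NewEdge a b → Fin (suc dim)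
  new-direction u-w₁  = zero
  new-direction w₁-w₂ = suc (direction uv)
  new-direction w₂-v  = zero

  new-crossed : ∀ {a b} (e : NewEdge a b) → label′ a (new-direction e) ≢ label′ b (new-direction e)
  new-crossed u-w₁  = λ ()
  new-crossed w₁-w₂ = direction-crossed uv
  new-crossed w₂-v  = λ ()

  new-others-fixed : ∀ {a b} (e : NewEdge a b) i → i ≢ new-direction e → label′ a i ≡ label′ b i
  new-others-fixed u-w₁  zero    i≢d = contradiction refl i≢d
  new-others-fixed u-w₁  (suc i) _   = refl
  new-others-fixed w₁-w₂ zero    _   = refl
  new-others-fixed w₁-w₂ (suc i) i≢d = others-fixed uv i (i≢d ∘ cong suc)
  new-others-fixed w₂-v  zero    i≢d = contradiction refl i≢d
  new-others-fixed w₂-v  (suc i) _   = refl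

  anchor′ : Fin (suc dim) → Fin (suc (suc n)) × Fin (suc (suc n))
  anchor′ zero    = old u , w₁
  anchor′ (suc i) = Product.map embed embed (anchor i)

  new-crossing-anchor-ribbon : ∀ i {a b} → NewEdge a b → label′ a i ≢ label′ b i →
                               SameRibbon G′ (anchor′ i) (a , b)
  new-crossing-anchor-ribbon zero    u-w₁  _  = ε
  new-crossing-anchor-ribbon zero    w₁-w₂ cr = contradiction refl cr
  new-crossing-anchor-ribbon zero    w₂-v  _  = opp square ◅ ε
  new-crossing-anchor-ribbon (suc i) u-w₁  cr = contradiction refl cr
  new-crossing-anchor-ribbon (suc i) w₁-w₂ cr =
    SameRibbon-map (crossing-anchor-ribbon i uv cr) ◅◅ flip ◅ opp square⁻¹ ◅ ε
  new-crossing-anchor-ribbon (suc i) w₂-v  cr = contradiction refl cr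

  direction′ : ∀ {a b} → Edge′ a b → Fin (suc dim)
  direction′ (old-edge e)   = suc (direction e)
  direction′ (new-edge e)   = new-direction e
  direction′ (new-edge⁻¹ e) = new-direction e

  direction′-crossed : ∀ {a b} (e : Edge′ a b) → label′ a (direction′ e) ≢ label′ b (direction′ e)
  direction′-crossed (old-edge e)   = direction-crossed e
  direction′-crossed (new-edge e)   = new-crossed e
  direction′-crossed (new-edge⁻¹ e) = ≢-sym (new-crossed e)

  others-fixed′ : ∀ {a b} (e : Edge′ a b) i → i ≢ direction′ e → label′ a i ≡ label′ b i
  others-fixed′ (old-edge e)   zero    _   = refl
  others-fixed′ (old-edge e)   (suc i) i≢d = others-fixed e i (i≢d ∘ cong suc)
  others-fixed′ (new-edge e)   i       i≢d = new-others-fixed e i i≢d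
  others-fixed′ (new-edge⁻¹ e) i       i≢d = sym (new-others-fixed e i i≢d)

  crossing-anchor′-ribbon : ∀ i {a b} → Edge′ a b → label′ a i ≢ label′ b i →
                            SameRibbon G′ (anchor′ i) (a , b)
  crossing-anchor′-ribbon zero    (old-edge e)   cr = contradiction refl cr
  crossing-anchor′-ribbon (suc i) (old-edge e)   cr = SameRibbon-map (crossing-anchor-ribbon i e cr)
  crossing-anchor′-ribbon i       (new-edge e)   cr = new-crossing-anchor-ribbon i e cr
  crossing-anchor′-ribbon i       (new-edge⁻¹ e) cr = new-crossing-anchor-ribbon i e (≢-sym cr) ◅◅ flip ◅ ε

  NonCrossingEdge′ : Fin (suc dim) → Fin (suc (suc n)) → Fin (suc (suc n)) → Set
  NonCrossingEdge′ = NonCrossingEdge G′ label′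

  lift : ∀ {i x y} → Star (NonCrossingEdge G label i) x y →
         Star (NonCrossingEdge′ (suc i)) (old x) (old y)
  lift = gmap embed λ (noncrossing e fixed) → noncrossing e fixed

  halfspace-connected-to-old : ∀ i a y → label′ a i ≡ label′ (old y) i →
                               Star (NonCrossingEdge′ i) a (old y)
  halfspace-connected-to-old zero    (old x) y _    = gmap embed (λ e → noncrossing e refl) (connected x y)
  halfspace-connected-to-old (suc i) (old x) y same = lift (halfspace-connected i same)
  halfspace-connected-to-old (suc i) w₁      y same =
    noncrossing edge-w₁-u refl ◅ lift (halfspace-connected i same)
  halfspace-connected-to-old (suc i) w₂      y same =
    noncrossing edge-w₂-v refl ◅ lift (halfspace-connected i same)

  halfspace-connected′ : ∀ i {a b} → label′ a i ≡ label′ b i → Star (NonCrossingEdge′ i) a b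
  halfspace-connected′ i {w₁}    {w₁}    _    = ε
  halfspace-connected′ i {w₁}    {w₂}    same = noncrossing refl same ◅ ε
  halfspace-connected′ i {w₂}    {w₁}    same = noncrossing refl same ◅ ε
  halfspace-connected′ i {w₂}    {w₂}    _    = ε
  halfspace-connected′ i {a}     {old y} same = halfspace-connected-to-old i a y same
  halfspace-connected′ i {old x} {b}     same =
    reverse (NonCrossingEdge-sym (λ {a} {b} → edge-sym′ {a} {b}))
            (halfspace-connected-to-old i b x (sym same))

  connected′ : Connected G′
  connected′ = connected-via (λ {a} {b} → edge-sym′ {a} {b}) (old u) to-u
    where
    to-u : ∀ x → Star (Edge G′) x (old u)
    to-u w₁      = edge-w₁-u ◅ ε
    to-u w₂      = refl ◅ to-u w₁
    to-u (old x) = path-map (connected x u)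

  cubeEmbedding : CubeEmbedding G′
  cubeEmbedding = record
    { dim                    = suc dim
    ; label                  = label′
    ; label-injective        = label′-injective
    ; edge-sym               = λ {a} {b} → edge-sym′ {a} {b}
    ; direction              = λ {a} {b} → direction′ ∘ classify {a} {b}
    ; direction-crossed      = λ {a} {b} → direction′-crossed ∘ classify {a} {b}
    ; others-fixed           = λ {a} {b} → others-fixed′ ∘ classify {a} {b}
    ; anchor                 = anchor′
    ; crossing-anchor-ribbon = λ i {a} {b} → crossing-anchor′-ribbon i ∘ classify {a} {b}
    ; halfspace-connected    = halfspace-connected′
    ; connected              = connected′
    }

module Close4 {n : ℕ} {G : Graph n} (C : CubeEmbedding G) {u v w : Fin n}
              (uv : Edge G u v) (vw : Edge G v w) (u≢w : u ≢ w) (closable : CloseCondition G u v w) where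
  open CubeEmbedding C
  open CubeEmbeddingProperties C
    using (edge-irreflexive; path₂-crosses-at-most-once; outside-ribbon⇒fixed; separated⇒crossing)

  G′ : Graph (suc n)
  G′ = close4 G u w

  pattern w′    = zero
  pattern old x = suc x

  open EdgeEmbedding {G = G} {H = G′} suc suc-injective (λ e → e)

  edge-w′-u : Edge G′ w′ (old u)
  edge-w′-u = cong (_∨ ⌊ u ≟ w ⌋) (⌊≟⌋-diag u)
  edge-u-w′ : Edge G′ (old u) w′
  edge-u-w′ = edge-w′-u
  edge-w′-w : Edge G′ w′ (old w)
  edge-w′-w = trans (cong (⌊ w ≟ u ⌋ ∨_) (⌊≟⌋-diag w)) (Bool.∨-zeroʳ _)

  edge-sym′ : ∀ {a b} → Edge G′ a b → Edge G′ b a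
  edge-sym′ {w′}    {old _} e = e
  edge-sym′ {old _} {w′}    e = e
  edge-sym′ {old _} {old _} e = edge-sym e

  square : FourCycle G′ (old u) w′ (old w) (old v)
  square = ( (λ ()) , u≢w ∘ suc-injective , edge-irreflexive uv ∘ suc-injective
           , (λ ()) , (λ ()) , ≢-sym (edge-irreflexive vw) ∘ suc-injective )
         , (edge-u-w′ , edge-w′-w , edge-sym vw , edge-sym uv)

  square² : FourCycle G′ (old w) (old v) (old u) w′
  square² = rotate (rotate square)
    where rotate = FourCycle-rotate {G = G′}

  square³ : FourCycle G′ (old v) (old u) w′ (old w)
  square³ = FourCycle-rotate {G = G′} square²

  -- The fourth corner u + w − v of the square u v w; over 𝔽₂ this is u + v + w.
  label′ : Fin (suc n) → Fin dim → Bool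
  label′ w′      i = label u i xor label v i xor label w i
  label′ (old x) i = label x i

  w′-label-fresh : ∀ y → ¬ (∀ i → label′ w′ i ≡ label y i)
  w′-label-fresh y same with y ≟ u | y ≟ v | y ≟ w
  ... | yes refl | _        | _        =
    edge-irreflexive vw (label-injective (λ i → xor-cancelʳ⁻¹ _ _ _ (same i)))
  ... | no _     | yes refl | _        =
    u≢w (label-injective (λ i → xor-middle⁻¹ _ _ _ (same i)))
  ... | no _     | no _     | yes refl =
    edge-irreflexive uv (label-injective (λ i → xor-cancelˡ⁻¹ _ _ _ (same i)))
  ... | no y≢u   | no y≢v   | no y≢w   with closable y y≢u y≢v y≢w
  -- u v w lies outside the ribbon of ab, so w′ shares v's side of it, and then so would y.
  ...   | _ , ab , uv∉ , vw∉ , separated = separated⇒crossing ab separated (trans (sym w′≡v) (same _))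
    where
    w′≡v : label′ w′ (direction ab) ≡ label v (direction ab)
    w′≡v = trans (xor-cancelˡ (label w _) (outside-ribbon⇒fixed ab uv uv∉))
                 (sym (outside-ribbon⇒fixed ab vw vw∉))

  label′-injective : ∀ {x y} → (∀ i → label′ x i ≡ label′ y i) → x ≡ y
  label′-injective {w′}    {w′}    _    = refl
  label′-injective {w′}    {old y} same = ⊥-elim (w′-label-fresh y same)
  label′-injective {old x} {w′}    same = ⊥-elim (w′-label-fresh x (sym ∘ same))
  label′-injective {old x} {old y} same = cong suc (label-injective same)

  data NewEdge : Fin (suc n) → Fin (suc n) → Set where
    w′-u : NewEdge w′ (old u)
    w′-w : NewEdge w′ (old w)

  Edge′ : Fin (suc n) → Fin (suc n) → Set
  Edge′ = ExtendedEdge G suc NewEdge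

  classify : ∀ {a b} → Edge G′ a b → Edge′ a b
  classify {w′} {old x} e with ⌊≟⌋∨⌊≟⌋⇒≡⊎≡ {x = x} {u} {w} e
  ... | inj₁ refl = new-edge w′-u
  ... | inj₂ refl = new-edge w′-w
  classify {old x} {w′} e with ⌊≟⌋∨⌊≟⌋⇒≡⊎≡ {x = x} {u} {w} e
  ... | inj₁ refl = new-edge⁻¹ w′-u
  ... | inj₂ refl = new-edge⁻¹ w′-w
  classify {old x} {old y} e = old-edge e

  new-direction : ∀ {a b} → NewEdge a b → Fin dim
  new-direction w′-u = direction vw
  new-direction w′-w = direction uv

  new-crossed : ∀ {a b} (e : NewEdge a b) → label′ a (new-direction e) ≢ label′ b (new-direction e)
  new-crossed w′-u = direction-crossed vw ∘ xor-cancelʳ⁻¹ _ _ _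
  new-crossed w′-w = direction-crossed uv ∘ xor-cancelˡ⁻¹ _ _ _

  new-others-fixed : ∀ {a b} (e : NewEdge a b) i → i ≢ new-direction e → label′ a i ≡ label′ b i
  new-others-fixed w′-u i i≢d = xor-cancelʳ (label u i) (others-fixed vw i i≢d)
  new-others-fixed w′-w i i≢d = xor-cancelˡ (label w i) (others-fixed uv i i≢d)

  anchor′ : Fin dim → Fin (suc n) × Fin (suc n)
  anchor′ = Product.map suc suc ∘ anchor

  new-crossing-anchor-ribbon : ∀ i {a b} → NewEdge a b → label′ a i ≢ label′ b i →
                               SameRibbon G′ (anchor′ i) (a , b)
  new-crossing-anchor-ribbon i w′-u cr =
    SameRibbon-map (crossing-anchor-ribbon i vw (cr ∘ xor-cancelʳ (label u i)))
      ◅◅ flip ◅ opp square² ◅ flip ◅ ε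
  new-crossing-anchor-ribbon i w′-w cr =
    SameRibbon-map (crossing-anchor-ribbon i uv (cr ∘ xor-cancelˡ (label w i)))
      ◅◅ flip ◅ opp square³ ◅ ε

  direction′ : ∀ {a b} → Edge′ a b → Fin dim
  direction′ (old-edge e)   = direction e
  direction′ (new-edge e)   = new-direction e
  direction′ (new-edge⁻¹ e) = new-direction e

  direction′-crossed : ∀ {a b} (e : Edge′ a b) → label′ a (direction′ e) ≢ label′ b (direction′ e)
  direction′-crossed (old-edge e)   = direction-crossed e
  direction′-crossed (new-edge e)   = new-crossed e
  direction′-crossed (new-edge⁻¹ e) = ≢-sym (new-crossed e)

  others-fixed′ : ∀ {a b} (e : Edge′ a b) i → i ≢ direction′ e → label′ a i ≡ label′ b i
  others-fixed′ (old-edge e)   i i≢d = others-fixed e i i≢d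
  others-fixed′ (new-edge e)   i i≢d = new-others-fixed e i i≢d
  others-fixed′ (new-edge⁻¹ e) i i≢d = sym (new-others-fixed e i i≢d)

  crossing-anchor′-ribbon : ∀ i {a b} → Edge′ a b → label′ a i ≢ label′ b i →
                            SameRibbon G′ (anchor′ i) (a , b)
  crossing-anchor′-ribbon i (old-edge e)   cr = SameRibbon-map (crossing-anchor-ribbon i e cr)
  crossing-anchor′-ribbon i (new-edge e)   cr = new-crossing-anchor-ribbon i e cr
  crossing-anchor′-ribbon i (new-edge⁻¹ e) cr = new-crossing-anchor-ribbon i e (≢-sym cr) ◅◅ flip ◅ ε

  NonCrossingEdge′ : Fin dim → Fin (suc n) → Fin (suc n) → Set
  NonCrossingEdge′ = NonCrossingEdge G′ label′

  lift : ∀ {i x y} → Star (NonCrossingEdge G label i) x y →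
         Star (NonCrossingEdge′ i) (old x) (old y)
  lift = gmap suc λ (noncrossing e fixed) → noncrossing e fixed

  halfspace-connected-from-w′ : ∀ i y → label′ w′ i ≡ label y i →
                                Star (NonCrossingEdge′ i) w′ (old y)
  halfspace-connected-from-w′ i y same with path₂-crosses-at-most-once uv vw u≢w i
  ... | inj₁ u≡v = noncrossing edge-w′-w w′≡w ◅ lift (halfspace-connected i (trans (sym w′≡w) same))
    where w′≡w = xor-cancelˡ (label w i) u≡v
  ... | inj₂ v≡w = noncrossing edge-w′-u w′≡u ◅ lift (halfspace-connected i (trans (sym w′≡u) same))
    where w′≡u = xor-cancelʳ (label u i) v≡w

  halfspace-connected′ : ∀ i {a b} → label′ a i ≡ label′ b i → Star (NonCrossingEdge′ i) a b
  halfspace-connected′ i {w′}    {w′}    _    = ε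
  halfspace-connected′ i {w′}    {old y} same = halfspace-connected-from-w′ i y same
  halfspace-connected′ i {old x} {w′}    same =
    reverse (NonCrossingEdge-sym (λ {a} {b} → edge-sym′ {a} {b}))
            (halfspace-connected-from-w′ i x (sym same))
  halfspace-connected′ i {old x} {old y} same = lift (halfspace-connected i same)

  connected′ : Connected G′
  connected′ = connected-via (λ {a} {b} → edge-sym′ {a} {b}) (old u) to-u
    where
    to-u : ∀ x → Star (Edge G′) x (old u)
    to-u w′      = edge-w′-u ◅ ε
    to-u (old x) = path-map (connected x u)

  cubeEmbedding : CubeEmbedding G′
  cubeEmbedding = record
    { dim                    = dim
    ; label                  = label′
    ; label-injective        = label′-injective
    ; edge-sym               = λ {a} {b} → edge-sym′ {a} {b}
    ; direction              = λ {a} {b} → direction′ ∘ classify {a} {b}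
    ; direction-crossed      = λ {a} {b} → direction′-crossed ∘ classify {a} {b}
    ; others-fixed           = λ {a} {b} → others-fixed′ ∘ classify {a} {b}
    ; anchor                 = anchor′
    ; crossing-anchor-ribbon = λ i {a} {b} → crossing-anchor′-ribbon i ∘ classify {a} {b}
    ; halfspace-connected    = halfspace-connected′
    ; connected              = connected′
    }

module Relabel {n : ℕ} {G H : Graph n} (C : CubeEmbedding G) (σ : Fin n ↔ Fin n)
               (H≗G∘σ : ∀ a b → H a b ≡ G (Inverse.to σ a) (Inverse.to σ b)) where
  open CubeEmbedding C
  open Inverse σ using (to; from; strictlyInverseˡ; strictlyInverseʳ)

  edge-to : ∀ {a b} → Edge H a b → Edge G (to a) (to b)
  edge-to {a} {b} e = trans (sym (H≗G∘σ a b)) e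

  edge-from : ∀ {p q} → Edge G p q → Edge H (from p) (from q)
  edge-from {p} {q} e =
    trans (H≗G∘σ (from p) (from q)) (trans (cong₂ G (strictlyInverseˡ p) (strictlyInverseˡ q)) e)

  from-injective : Injective _≡_ _≡_ from
  from-injective {p} {q} eq = trans (sym (strictlyInverseˡ p)) (trans (cong to eq) (strictlyInverseˡ q))

  open EdgeEmbedding {G = G} {H = H} from from-injective (λ {p} {q} → edge-from {p} {q})

  label′ : Fin n → Fin dim → Bool
  label′ = label ∘ to

  lift : ∀ {i p q} → NonCrossingEdge G label i p q → NonCrossingEdge H label′ i (from p) (from q)
  lift {i} {p} {q} (noncrossing e fixed) =
    noncrossing (edge-from e) (subst₂ (λ p′ q′ → label p′ i ≡ label q′ i)
                                      (sym (strictlyInverseˡ p)) (sym (strictlyInverseˡ q)) fixed)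

  cubeEmbedding : CubeEmbedding H
  cubeEmbedding = record
    { dim                    = dim
    ; label                  = label′
    ; label-injective        = λ {x} {y} same →
        trans (sym (strictlyInverseʳ x)) (trans (cong from (label-injective same)) (strictlyInverseʳ y))
    ; edge-sym               = λ {a} {b} e → trans (H≗G∘σ b a) (edge-sym (edge-to {a} {b} e))
    ; direction              = λ {a} {b} e → direction (edge-to {a} {b} e)
    ; direction-crossed      = λ {a} {b} e → direction-crossed (edge-to {a} {b} e)
    ; others-fixed           = λ {a} {b} e → others-fixed (edge-to {a} {b} e)
    ; anchor                 = Product.map from from ∘ anchor
    ; crossing-anchor-ribbon = λ i {a} {b} e cr →
        subst (SameRibbon H (Product.map from from (anchor i)))
              (cong₂ _,_ (strictlyInverseʳ a) (strictlyInverseʳ b))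
              (SameRibbon-map (crossing-anchor-ribbon i (edge-to {a} {b} e) cr))
    ; halfspace-connected    = λ i {x} {y} same →
        subst₂ (Star (NonCrossingEdge H label′ i)) (strictlyInverseʳ x) (strictlyInverseʳ y)
               (gmap from lift (halfspace-connected i same))
    ; connected              = λ x y →
        subst₂ (Star (Edge H)) (strictlyInverseʳ x) (strictlyInverseʳ y)
               (path-map (connected (to x) (to y)))
    }

K₂ : Graph 2
K₂ 0F 1F = true
K₂ 1F 0F = true
K₂ _  _  = false

K₂-cubeEmbedding : CubeEmbedding K₂
K₂-cubeEmbedding = record
  { dim                    = 1
  ; label                  = label
  ; label-injective        = λ same → label-injective (same 0F)
  ; edge-sym               = λ {a} {b} → edge-sym {a} {b}
  ; direction              = λ _ → 0F
  ; direction-crossed      = λ {a} {b} → crossed {a} {b}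
  ; others-fixed           = λ { _ 0F i≢0 → contradiction refl i≢0 }
  ; anchor                 = λ _ → 0F , 1F
  ; crossing-anchor-ribbon = λ { 0F {a} {b} → anchor-ribbon {a} {b} }
  ; halfspace-connected    = λ { 0F {x} same → subst (Star _ x) (label-injective same) ε }
  ; connected              =
      connected-via (λ {a} {b} → edge-sym {a} {b}) 0F λ { 0F → ε ; 1F → refl ◅ ε }
  }
  where
  label : Fin 2 → Fin 1 → Bool
  label 0F _ = false
  label 1F _ = true

  label-injective : ∀ {x y} → label x 0F ≡ label y 0F → x ≡ y
  label-injective {0F} {0F} _ = refl
  label-injective {1F} {1F} _ = refl
  label-injective {0F} {1F} ()
  label-injective {1F} {0F} ()

  edge-sym : ∀ {a b} → Edge K₂ a b → Edge K₂ b a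
  edge-sym {0F} {1F} _ = refl
  edge-sym {1F} {0F} _ = refl
  edge-sym {0F} {0F} ()
  edge-sym {1F} {1F} ()

  crossed : ∀ {a b} → Edge K₂ a b → label a 0F ≢ label b 0F
  crossed {0F} {1F} _ = λ ()
  crossed {1F} {0F} _ = λ ()
  crossed {0F} {0F} ()
  crossed {1F} {1F} ()

  anchor-ribbon : ∀ {a b} → Edge K₂ a b → label a 0F ≢ label b 0F → SameRibbon K₂ (0F , 1F) (a , b)
  anchor-ribbon {0F} {1F} _ _ = ε
  anchor-ribbon {1F} {0F} _ _ = flip ◅ ε
  anchor-ribbon {0F} {0F} ()
  anchor-ribbon {1F} {1F} ()

-- The 4-cycle is Add4-cycle applied to a single edge, up to swapping vertices 2 and 3.
C4-cubeEmbedding : CubeEmbedding C4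
C4-cubeEmbedding =
  Relabel.cubeEmbedding (Add4.cubeEmbedding K₂-cubeEmbedding {0F} {1F} refl) τ C4≗add4K₂∘τ
  where
  τ = transpose 2F 3F
  C4≗add4K₂∘τ : ∀ a b → C4 a b ≡ add4 K₂ 0F 1F (Inverse.to τ a) (Inverse.to τ b)
  C4≗add4K₂∘τ =
    from-yes (all? λ a → all? λ b → C4 a b Bool.≟ add4 K₂ 0F 1F (Inverse.to τ a) (Inverse.to τ b))

cubeEmbedding : ∀ {n} {G : Graph n} → Rec G → CubeEmbedding G
cubeEmbedding base                           = C4-cubeEmbedding
cubeEmbedding (add4C r uv)                   = Add4.cubeEmbedding (cubeEmbedding r) uv
cubeEmbedding (close4C r uv vw u≢w closable) = Close4.cubeEmbedding (cubeEmbedding r) uv vw u≢w closable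
cubeEmbedding (relabel r σ H≗G∘σ)            = Relabel.cubeEmbedding (cubeEmbedding r) σ H≗G∘σ

corollary3p15 : ∀ {n : ℕ} (G : Graph n) → Rec G →
                  Σ (Fin n → Point) λ ρ → PFramework G ρ
corollary3p15 G r = CubeEmbeddingProperties.pFramework (cubeEmbedding r)
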